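{- Let $G$ be a graph, $u,v$ distinct non-adjacent vertices, and $S_a,S_b$ any pair of $uv$-separators in $G$ with $|S_a|=|S_b|=k$. Then $S_a$ can be reconfigured into $S_b$ under TJ if and only if $S_a$ can be reconfigured into $S_b$ under $(k+1)$-TAR, and $\mathrm{dist}_{TJ}(G,S_a,S_b)=\mathrm{dist}_{(k+1)\text{ - }TAR}(G,S_a,S_b)/2$.
   Context: A set $S\subseteq V(G)\setminus\{u,v\}$ is a $uv$-separator if $u$ and $v$ lie in different components of $G-S$. A reconfiguration sequence is a sequence of $uv$-separators with consecutive sets adjacent. TJ: $S,S'$ adjacent if $|S|=|S'|$ and $|S\setminus S'|=|S'\setminus S|=1$. $k$-TAR: $S,S'$ adjacent if $|S\triangle S'|=1$ and $\max(|S|,|S'|)\le k$. $\mathrm{dist}_X(G,S_a,S_b)$ is the minimum number of steps in a reconfiguration sequence from $S_a$ to $S_b$ under rule $X$. -}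

module Defs where

open import Data.Nat using (ℕ; zero; suc; _≤_; _⊔_)
open import Data.Fin using (Fin)
open import Data.Fin.Subset using (Subset; _∈_; _∉_; _∪_; _─_; ∣_∣)
open import Data.Product using (_×_; Σ; ∃)
open import Relation.Binary.PropositionalEquality using (_≡_)
open import Relation.Nullary using (¬_; Dec)
open import Data.Empty using (⊥)

record Graph (n : ℕ) : Set₁ where
  field
    E      : Fin n → Fin n → Set
    sym    : ∀ {x y} → E x y → E y x
    irrefl : ∀ {x} → ¬ E x x
    dec    : ∀ x y → Dec (E x y)
open Graph public

module _ {n : ℕ} (G : Graph n) where

  data WalkAvoiding (S : Subset n) : Fin n → Fin n → Set where
    here : ∀ {x} → x ∉ S → WalkAvoiding S x x
    step : ∀ {x y z} → x ∉ S → E G x y → WalkAvoiding S y z → WalkAvoiding S x z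

  IsSeparator : Fin n → Fin n → Subset n → Set
  IsSeparator u v S = u ∉ S × v ∉ S × ¬ WalkAvoiding S u v

  TJ : Subset n → Subset n → Set
  TJ S S' = ∣ S ∣ ≡ ∣ S' ∣ × ∣ S ─ S' ∣ ≡ 1 × ∣ S' ─ S ∣ ≡ 1

  TAR : ℕ → Subset n → Subset n → Set
  TAR k S S' = ∣ (S ─ S') ∪ (S' ─ S) ∣ ≡ 1 × (∣ S ∣ ⊔ ∣ S' ∣) ≤ k

  data Reach (u v : Fin n) (Adj : Subset n → Subset n → Set)
       : ℕ → Subset n → Subset n → Set where
    done : ∀ {S} → IsSeparator u v S → Reach u v Adj zero S S
    move : ∀ {m S S' T} → IsSeparator u v S → Adj S S' →
           Reach u v Adj m S' T → Reach u v Adj (suc m) S T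

  Reconfigurable : Fin n → Fin n → (Subset n → Subset n → Set) → Subset n → Subset n → Set
  Reconfigurable u v Adj S T = ∃ λ m → Reach u v Adj m S T

  IsDist : Fin n → Fin n → (Subset n → Subset n → Set) → Subset n → Subset n → ℕ → Set
  IsDist u v Adj S T d = Reach u v Adj d S T × (∀ m → Reach u v Adj m S T → d ≤ m)

module Submission where

-- A subset of Fin n is a boolean vector, and both reconfiguration rules are
-- phrased through the operation  flip S x  that toggles the membership of x.
-- A (k+1)-TAR step is exactly  S ↦ flip S x  (the symmetric difference is a
-- singleton), and a TJ step is exactly  S ↦ flip (flip S y) x  with x ∈ S,
-- y ∉ S.
--
-- Doubling (TJ ⇒ TAR): a jump S ↦ S - x + y is replaced by the two TAR steps
-- S ↦ S + y ↦ S - x + y; the middle set has size k + 1 and, being a superset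
-- of the separator S, is itself a separator.
--
-- Halving (TAR ⇒ TJ): along a TAR sequence S = S₀, …, S_m = T with |T| = k we
-- keep a separator A ⊇ Sᵢ of size k, proving by induction on the sequence
-- that A reaches T in t jumps with 2t + |S| ≤ m + k.  Removals and additions
-- inside A keep A; an addition of x ∉ A is matched by the jump z ↦ x for some
-- z ∈ A ∖ S, or, when A = S (so S + x has size k + 1), together with the next
-- step, which must be a removal.
--
-- A general remark on length-doubling simulations then turns these two
-- translations into the equivalence of reachability and the relation
-- dist_TAR = 2 · dist_TJ.

open import Defs hiding (sym)
open import Data.Bool using (true; false; not; _∧_; _∨_; _xor_)
open import Data.Bool.Properties
  using (xor-assoc; xor-same; xor-identityˡ; xor-identityʳ; xor-comm; true-xor;
         ∧-conicalˡ; ∧-conicalʳ; not-injective)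
open import Data.Nat using (ℕ; suc; _+_; _*_; _≤_; s≤s)
open import Data.Nat.Properties
  using (suc-injective; 1+n≢n; 1+n≰n; n≤1+n; m≤n+m; ≤-reflexive; ≤-trans;
         ≤-antisym; +-suc; +-mono-≤; +-monoʳ-≤; +-cancelʳ-≤; *-suc; *-monoʳ-≤;
         *-cancelˡ-≤; ⊔-lub; m≤n⊔m)
open import Data.Fin using (Fin; zero; suc; _≟_)
open import Data.Fin.Subset using (Subset; _∈_; _∉_; _⊆_; _─_; _∪_; ∣_∣; ⁅_⁆; ⊥)
open import Data.Fin.Subset.Properties
  using (_∈?_; nonempty?; x∈⁅x⁆; x∈⁅y⁆⇒x≡y; x≢y⇒x∉⁅y⁆; ∣⁅x⁆∣≡1; ⊆-refl;
         ⊆-antisym; p⊂q⇒∣p∣<∣q∣; x∈p∧x∉q⇒x∈p─q)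
open import Data.Vec using ([]; _∷_; lookup; tabulate; _[_]≔_; here; there)
open import Data.Vec.Properties
  using (lookup∘update; lookup∘update′; []=⇒lookup; lookup⇒[]=; tabulate∘lookup;
         tabulate-cong; lookup-zipWith)
open import Data.Product using (∃; ∃₂; _×_; _,_; proj₁; proj₂)
open import Data.Sum using (_⊎_; inj₁; inj₂)
open import Data.Empty using (⊥-elim)
open import Function using (_∘_)
open import Function.Bundles using (_⇔_; mk⇔)
open import Relation.Binary.PropositionalEquality
  using (_≡_; _≢_; refl; sym; trans; cong; cong₂; subst; module ≡-Reasoning)
open import Relation.Nullary using (¬_; yes; no)
open import Relation.Nullary.Negation using (contradiction)

open ≡-Reasoning

private
  variable
    n : ℕ
    p q : Subset n
    i x y z : Fin n

∈⇒true : i ∈ p → lookup p i ≡ true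
∈⇒true = []=⇒lookup

true⇒∈ : lookup p i ≡ true → i ∈ p
true⇒∈ {p = p} {i} = lookup⇒[]= i p

∉⇒false : i ∉ p → lookup p i ≡ false
∉⇒false {i = i} {p} i∉p with lookup p i in bit
... | true  = contradiction (lookup⇒[]= i p bit) i∉p
... | false = refl

false⇒∉ : lookup p i ≡ false → i ∉ p
false⇒∉ bit i∈p with trans (sym (∈⇒true i∈p)) bit
... | ()

∈-∉-≢ : i ∈ p → x ∉ p → i ≢ x
∈-∉-≢ i∈p x∉p refl = x∉p i∈p

subset-ext : (∀ i → lookup p i ≡ lookup q i) → p ≡ q
subset-ext {p = p} {q} same = begin
  p                   ≡⟨ sym (tabulate∘lookup p) ⟩
  tabulate (lookup p) ≡⟨ tabulate-cong same ⟩
  tabulate (lookup q) ≡⟨ tabulate∘lookup q ⟩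
  q                   ∎

lookup-─ : ∀ (p q : Subset n) i → lookup (p ─ q) i ≡ lookup p i ∧ not (lookup q i)
lookup-─ (a ∷ p) (true  ∷ q) zero    with a
... | true  = refl
... | false = refl
lookup-─ (a ∷ p) (false ∷ q) zero    with a
... | true  = refl
... | false = refl
lookup-─ (a ∷ p) (b ∷ q)     (suc i) = lookup-─ p q i

∈-─⁻ : i ∈ p ─ q → i ∈ p × i ∉ q
∈-─⁻ {i = i} {p} {q} i∈p─q =
  true⇒∈ (∧-conicalˡ _ _ bit) , false⇒∉ (not-injective (∧-conicalʳ _ _ bit))
  where
  bit : lookup p i ∧ not (lookup q i) ≡ true
  bit = trans (sym (lookup-─ p q i)) (∈⇒true i∈p─q)

Δ : Subset n → Subset n → Subset n
Δ p q = (p ─ q) ∪ (q ─ p)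

∨-diff≡xor : ∀ a b → (a ∧ not b) ∨ (b ∧ not a) ≡ a xor b
∨-diff≡xor true  true  = refl
∨-diff≡xor true  false = refl
∨-diff≡xor false true  = refl
∨-diff≡xor false false = refl

lookup-Δ : ∀ (p q : Subset n) i → lookup (Δ p q) i ≡ lookup p i xor lookup q i
lookup-Δ p q i = begin
  lookup ((p ─ q) ∪ (q ─ p)) i        ≡⟨ lookup-zipWith _∨_ i (p ─ q) (q ─ p) ⟩
  lookup (p ─ q) i ∨ lookup (q ─ p) i ≡⟨ cong₂ _∨_ (lookup-─ p q i) (lookup-─ q p i) ⟩
  (lookup p i ∧ not (lookup q i)) ∨ (lookup q i ∧ not (lookup p i))
                                      ≡⟨ ∨-diff≡xor (lookup p i) (lookup q i) ⟩
  lookup p i xor lookup q i           ∎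

xor-cancelˡ : ∀ a b → a xor (a xor b) ≡ b
xor-cancelˡ a b = begin
  a xor (a xor b) ≡⟨ sym (xor-assoc a a b) ⟩
  (a xor a) xor b ≡⟨ cong (_xor b) (xor-same a) ⟩
  false xor b     ≡⟨ xor-identityˡ b ⟩
  b               ∎

lookup-⁅x⁆-same : ∀ (x : Fin n) → lookup ⁅ x ⁆ x ≡ true
lookup-⁅x⁆-same x = ∈⇒true (x∈⁅x⁆ x)

lookup-⁅x⁆-other : i ≢ x → lookup ⁅ x ⁆ i ≡ false
lookup-⁅x⁆-other i≢x = ∉⇒false (x≢y⇒x∉⁅y⁆ i≢x)

∣p∣≡0⇒p≡⊥ : ∣ p ∣ ≡ 0 → p ≡ ⊥
∣p∣≡0⇒p≡⊥ {p = []}        _     = refl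
∣p∣≡0⇒p≡⊥ {p = false ∷ p} empty = cong (false ∷_) (∣p∣≡0⇒p≡⊥ empty)

∣p∣≡1⇒singleton : ∀ (p : Subset n) → ∣ p ∣ ≡ 1 → ∃ λ x → p ≡ ⁅ x ⁆
∣p∣≡1⇒singleton (true ∷ p)  one = zero , cong (true ∷_) (∣p∣≡0⇒p≡⊥ (suc-injective one))
∣p∣≡1⇒singleton (false ∷ p) one with ∣p∣≡1⇒singleton p one
... | x , p≡⁅x⁆ = suc x , cong (false ∷_) p≡⁅x⁆

─-singleton : x ∈ p → x ∉ q → (∀ {i} → i ∈ p → i ∉ q → i ≡ x) → p ─ q ≡ ⁅ x ⁆
─-singleton {x = x} {p} {q} x∈p x∉q unique = ⊆-antisym ⊆⁅x⁆ ⁅x⁆⊆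
  where
  ⊆⁅x⁆ : p ─ q ⊆ ⁅ x ⁆
  ⊆⁅x⁆ i∈p─q with ∈-─⁻ {p = p} i∈p─q
  ... | i∈p , i∉q = subst (_∈ ⁅ x ⁆) (sym (unique i∈p i∉q)) (x∈⁅x⁆ x)
  ⁅x⁆⊆ : ⁅ x ⁆ ⊆ p ─ q
  ⁅x⁆⊆ i∈⁅x⁆ = subst (_∈ p ─ q) (sym (x∈⁅y⁆⇒x≡y x i∈⁅x⁆)) (x∈p∧x∉q⇒x∈p─q x∈p x∉q)

-- Toggling the membership of a single element.  The definition is opaque:
-- everything else follows from the lookup equations and size changes below.

opaque
  flip : Subset n → Fin n → Subset n
  flip p x = p [ x ]≔ not (lookup p x)

  lookup-flip-same : lookup (flip p x) x ≡ not (lookup p x)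
  lookup-flip-same {p = p} {x} = lookup∘update x p _

  lookup-flip-other : i ≢ x → lookup (flip p x) i ≡ lookup p i
  lookup-flip-other {p = p} i≢x = lookup∘update′ i≢x p _

  ∣flip∣-∉ : x ∉ p → ∣ flip p x ∣ ≡ suc ∣ p ∣
  ∣flip∣-∉ {x = zero}  {true  ∷ p} x∉p = contradiction here x∉p
  ∣flip∣-∉ {x = zero}  {false ∷ p} x∉p = refl
  ∣flip∣-∉ {x = suc x} {true  ∷ p} x∉p = cong suc (∣flip∣-∉ (x∉p ∘ there))
  ∣flip∣-∉ {x = suc x} {false ∷ p} x∉p = ∣flip∣-∉ (x∉p ∘ there)

  ∣flip∣-∈ : x ∈ p → suc ∣ flip p x ∣ ≡ ∣ p ∣
  ∣flip∣-∈ {p = true  ∷ p} here        = refl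
  ∣flip∣-∈ {p = true  ∷ p} (there x∈p) = cong suc (∣flip∣-∈ x∈p)
  ∣flip∣-∈ {p = false ∷ p} (there x∈p) = ∣flip∣-∈ x∈p

lookup-flip : ∀ (p : Subset n) x i → lookup (flip p x) i ≡ lookup p i xor lookup ⁅ x ⁆ i
lookup-flip p x i with i ≟ x
... | yes refl = begin
  lookup (flip p x) x  ≡⟨ lookup-flip-same ⟩
  not (lookup p x)     ≡⟨ sym (trans (xor-comm (lookup p x) true) (true-xor (lookup p x))) ⟩
  lookup p x xor true  ≡⟨ cong (lookup p x xor_) (sym (lookup-⁅x⁆-same x)) ⟩
  lookup p x xor lookup ⁅ x ⁆ x ∎
... | no i≢x = begin
  lookup (flip p x) i  ≡⟨ lookup-flip-other i≢x ⟩
  lookup p i           ≡⟨ sym (xor-identityʳ (lookup p i)) ⟩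
  lookup p i xor false ≡⟨ cong (lookup p i xor_) (sym (lookup-⁅x⁆-other i≢x)) ⟩
  lookup p i xor lookup ⁅ x ⁆ i ∎

flip-involutive : ∀ (p : Subset n) x → flip (flip p x) x ≡ p
flip-involutive p x = subset-ext λ i → begin
  lookup (flip (flip p x) x) i                       ≡⟨ lookup-flip (flip p x) x i ⟩
  lookup (flip p x) i xor lookup ⁅ x ⁆ i             ≡⟨ cong (_xor lookup ⁅ x ⁆ i) (lookup-flip p x i) ⟩
  (lookup p i xor lookup ⁅ x ⁆ i) xor lookup ⁅ x ⁆ i ≡⟨ xor-assoc (lookup p i) _ _ ⟩
  lookup p i xor (lookup ⁅ x ⁆ i xor lookup ⁅ x ⁆ i) ≡⟨ cong (lookup p i xor_) (xor-same (lookup ⁅ x ⁆ i)) ⟩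
  lookup p i xor false                               ≡⟨ xor-identityʳ (lookup p i) ⟩
  lookup p i                                         ∎

∈-flip-self : x ∉ p → x ∈ flip p x
∈-flip-self x∉p = true⇒∈ (trans lookup-flip-same (cong not (∉⇒false x∉p)))

∉-flip-self : x ∈ p → x ∉ flip p x
∉-flip-self x∈p = false⇒∉ (trans lookup-flip-same (cong not (∈⇒true x∈p)))

∈-flip : i ≢ x → i ∈ p → i ∈ flip p x
∈-flip i≢x i∈p = true⇒∈ (trans (lookup-flip-other i≢x) (∈⇒true i∈p))

∈-flip⁻ : i ≢ x → i ∈ flip p x → i ∈ p
∈-flip⁻ i≢x i∈ = true⇒∈ (trans (sym (lookup-flip-other i≢x)) (∈⇒true i∈))

∉-flip : i ≢ x → i ∉ p → i ∉ flip p x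
∉-flip i≢x i∉p = i∉p ∘ ∈-flip⁻ i≢x

∣p∣≤1+∣flip∣ : ∀ (p : Subset n) x → ∣ p ∣ ≤ suc ∣ flip p x ∣
∣p∣≤1+∣flip∣ p x with x ∈? p
... | yes x∈p = ≤-reflexive (sym (∣flip∣-∈ x∈p))
... | no  x∉p = subst (∣ p ∣ ≤_) (cong suc (sym (∣flip∣-∉ x∉p))) (m≤n+m ∣ p ∣ 2)

flip-⊆ : p ⊆ q → x ∈ q → flip p x ⊆ q
flip-⊆ {x = x} p⊆q x∈q {i} i∈ with i ≟ x
... | yes refl = x∈q
... | no  i≢x  = p⊆q (∈-flip⁻ i≢x i∈)

flip-mono : p ⊆ q → x ∉ q → flip p x ⊆ flip q x
flip-mono {x = x} p⊆q x∉q {i} i∈ with i ≟ x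
... | yes refl = ∈-flip-self x∉q
... | no  i≢x  = ∈-flip i≢x (p⊆q (∈-flip⁻ i≢x i∈))

⊆-flip-∉ : p ⊆ q → z ∉ p → p ⊆ flip q z
⊆-flip-∉ p⊆q z∉p i∈p = ∈-flip (∈-∉-≢ i∈p z∉p) (p⊆q i∈p)

⊆-split : p ⊆ q → p ≡ q ⊎ ∃ λ z → z ∈ q × z ∉ p
⊆-split {p = p} {q} p⊆q with nonempty? (q ─ p)
... | yes (z , z∈q─p) = inj₂ (z , ∈-─⁻ {p = q} z∈q─p)
... | no  nothing-missing = inj₁ (⊆-antisym p⊆q q⊆p)
  where
  q⊆p : q ⊆ p
  q⊆p {i} i∈q with i ∈? p
  ... | yes i∈p = i∈p
  ... | no  i∉p = ⊥-elim (nothing-missing (i , x∈p∧x∉q⇒x∈p─q i∈q i∉p))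

⊆⇒≡ : p ⊆ q → ∣ q ∣ ≤ ∣ p ∣ → p ≡ q
⊆⇒≡ p⊆q ∣q∣≤∣p∣ with ⊆-split p⊆q
... | inj₁ p≡q             = p≡q
... | inj₂ (z , z∈q , z∉p) =
  contradiction (≤-trans (p⊂q⇒∣p∣<∣q∣ (p⊆q , z , z∈q , z∉p)) ∣q∣≤∣p∣) 1+n≰n

TAR-step⇒flip : ∀ {S S' : Subset n} → ∣ Δ S S' ∣ ≡ 1 → ∃ λ x → S' ≡ flip S x
TAR-step⇒flip {S = S} {S'} one with ∣p∣≡1⇒singleton (Δ S S') one
... | x , Δ≡⁅x⁆ = x , subset-ext λ i → begin
  lookup S' i                              ≡⟨ sym (xor-cancelˡ (lookup S i) (lookup S' i)) ⟩
  lookup S i xor (lookup S i xor lookup S' i) ≡⟨ cong (lookup S i xor_) (sym (lookup-Δ S S' i)) ⟩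
  lookup S i xor lookup (Δ S S') i         ≡⟨ cong (λ D → lookup S i xor lookup D i) Δ≡⁅x⁆ ⟩
  lookup S i xor lookup ⁅ x ⁆ i            ≡⟨ sym (lookup-flip S x i) ⟩
  lookup (flip S x) i                      ∎

flip⇒TAR-step : ∀ (S : Subset n) x → ∣ Δ S (flip S x) ∣ ≡ 1
flip⇒TAR-step S x = trans (cong ∣_∣ (subset-ext {p = Δ S (flip S x)} {q = ⁅ x ⁆} Δ≗⁅x⁆)) (∣⁅x⁆∣≡1 x)
  where
  Δ≗⁅x⁆ : ∀ i → lookup (Δ S (flip S x)) i ≡ lookup ⁅ x ⁆ i
  Δ≗⁅x⁆ i = begin
    lookup (Δ S (flip S x)) i                      ≡⟨ lookup-Δ S (flip S x) i ⟩
    lookup S i xor lookup (flip S x) i             ≡⟨ cong (lookup S i xor_) (lookup-flip S x i) ⟩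
    lookup S i xor (lookup S i xor lookup ⁅ x ⁆ i) ≡⟨ xor-cancelˡ (lookup S i) _ ⟩
    lookup ⁅ x ⁆ i                                 ∎

recover : ∀ a b → b ≡ (a xor (b ∧ not a)) xor (a ∧ not b)
recover true  true  = refl
recover true  false = refl
recover false true  = refl
recover false false = refl

jump : Subset n → Fin n → Fin n → Subset n
jump S x y = flip (flip S y) x

TJ⇒jump : ∀ {S S' : Subset n} → ∣ S ─ S' ∣ ≡ 1 → ∣ S' ─ S ∣ ≡ 1 →
          ∃₂ λ x y → x ∈ S × y ∉ S × S' ≡ jump S x y
TJ⇒jump {S = S} {S'} out in' with ∣p∣≡1⇒singleton (S ─ S') out | ∣p∣≡1⇒singleton (S' ─ S) in'
... | x , S─S'≡⁅x⁆ | y , S'─S≡⁅y⁆ =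
  x , y , proj₁ (∈-─⁻ {p = S} (∈-of S─S'≡⁅x⁆)) , proj₂ (∈-─⁻ {p = S'} (∈-of S'─S≡⁅y⁆)) ,
  subset-ext pointwise
  where
  ∈-of : ∀ {D : Subset _} {w} → D ≡ ⁅ w ⁆ → w ∈ D
  ∈-of {w = w} D≡⁅w⁆ = subst (w ∈_) (sym D≡⁅w⁆) (x∈⁅x⁆ w)
  pointwise : ∀ i → lookup S' i ≡ lookup (jump S x y) i
  pointwise i = begin
    lookup S' i
      ≡⟨ recover (lookup S i) (lookup S' i) ⟩
    (lookup S i xor (lookup S' i ∧ not (lookup S i))) xor (lookup S i ∧ not (lookup S' i))
      ≡⟨ sym (cong₂ (λ b c → (lookup S i xor b) xor c) (lookup-─ S' S i) (lookup-─ S S' i)) ⟩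
    (lookup S i xor lookup (S' ─ S) i) xor lookup (S ─ S') i
      ≡⟨ cong₂ (λ D E → (lookup S i xor lookup D i) xor lookup E i) S'─S≡⁅y⁆ S─S'≡⁅x⁆ ⟩
    (lookup S i xor lookup ⁅ y ⁆ i) xor lookup ⁅ x ⁆ i
      ≡⟨ cong (_xor lookup ⁅ x ⁆ i) (sym (lookup-flip S y i)) ⟩
    lookup (flip S y) i xor lookup ⁅ x ⁆ i
      ≡⟨ sym (lookup-flip (flip S y) x i) ⟩
    lookup (jump S x y) i ∎

module _ {S : Subset n} (x∈S : x ∈ S) (y∉S : y ∉ S) where

  private
    y≢x : y ≢ x
    y≢x = ∈-∉-≢ x∈S y∉S ∘ sym

    x∈S+y : x ∈ flip S y
    x∈S+y = ∈-flip (y≢x ∘ sym) x∈S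

  x∉jump : x ∉ jump S x y
  x∉jump = ∉-flip-self x∈S+y

  y∈jump : y ∈ jump S x y
  y∈jump = ∈-flip y≢x (∈-flip-self y∉S)

  ∣jump∣ : ∣ jump S x y ∣ ≡ ∣ S ∣
  ∣jump∣ = suc-injective (trans (∣flip∣-∈ x∈S+y) (∣flip∣-∉ y∉S))

  jump⇒TJ : ∣ S ∣ ≡ ∣ jump S x y ∣ × ∣ S ─ jump S x y ∣ ≡ 1 × ∣ jump S x y ─ S ∣ ≡ 1
  jump⇒TJ =
    sym ∣jump∣ ,
    trans (cong ∣_∣ (─-singleton x∈S x∉jump only-x-leaves)) (∣⁅x⁆∣≡1 x) ,
    trans (cong ∣_∣ (─-singleton y∈jump y∉S only-y-enters)) (∣⁅x⁆∣≡1 y)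
    where
    only-x-leaves : ∀ {i} → i ∈ S → i ∉ jump S x y → i ≡ x
    only-x-leaves {i} i∈S i∉J with i ≟ x
    ... | yes i≡x = i≡x
    ... | no  i≢x = contradiction (∈-flip i≢x (∈-flip (∈-∉-≢ i∈S y∉S) i∈S)) i∉J
    only-y-enters : ∀ {i} → i ∈ jump S x y → i ∉ S → i ≡ y
    only-y-enters {i} i∈J i∉S with i ≟ y
    ... | yes i≡y = i≡y
    ... | no  i≢y = contradiction (∈-flip⁻ i≢y (∈-flip⁻ (∈-∉-≢ i∈J x∉jump) i∈J)) i∉S

double-suc : ∀ t → 2 * suc t ≡ suc (suc (2 * t))
double-suc t = *-suc 2 t

cancel-size : ∀ {a m s k} → a + s ≤ m + k → s ≡ k → a ≤ m
cancel-size {a} {m} {k = k} le refl = +-cancelʳ-≤ k a m le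

-- A jump paid for by two TAR steps.
double-cost : ∀ t m → 2 * t ≤ m → 2 * suc t ≤ suc (suc m)
double-cost t m b = subst (_≤ suc (suc m)) (sym (double-suc t)) (s≤s (s≤s b))

-- A TAR step changing the size by at most one costs one unit.
step-cost : ∀ t m k {s s′} → s ≤ suc s′ → 2 * t + s′ ≤ m + k → 2 * t + s ≤ suc m + k
step-cost t m k {s} {s′} s≤ b =
  ≤-trans (+-monoʳ-≤ (2 * t) s≤) (subst (_≤ suc m + k) (sym (+-suc (2 * t) s′)) (s≤s b))

-- A jump costs two units, one paid by the TAR step and one by the token gained.
jump-cost : ∀ t m k {s} → 2 * t + suc s ≤ m + k → 2 * suc t + s ≤ suc m + k
jump-cost t m k {s} b = subst (_≤ suc m + k) shift (s≤s b)
  where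
  shift : suc (2 * t + suc s) ≡ 2 * suc t + s
  shift = trans (cong suc (+-suc (2 * t) s)) (sym (cong (_+ s) (double-suc t)))

module Separators {n} (G : Graph n) (u v : Fin n) where

  walk-⊆ : ∀ {S A : Subset n} {a b} → S ⊆ A → WalkAvoiding G A a b → WalkAvoiding G S a b
  walk-⊆ S⊆A (here a∉A)        = here (a∉A ∘ S⊆A)
  walk-⊆ S⊆A (step a∉A e rest) = step (a∉A ∘ S⊆A) e (walk-⊆ S⊆A rest)

  separator-⊆ : ∀ {S A : Subset n} → S ⊆ A → u ∉ A → v ∉ A →
                IsSeparator G u v S → IsSeparator G u v A
  separator-⊆ S⊆A u∉A v∉A (_ , _ , no-walk) = u∉A , v∉A , no-walk ∘ walk-⊆ S⊆A

  source-separator : ∀ {Adj m S T} → Reach G u v Adj m S T → IsSeparator G u v S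
  source-separator (done sep)     = sep
  source-separator (move sep _ _) = sep

module Translation {n} (G : Graph n) (u v : Fin n) (k : ℕ) where
  open Separators G u v

  TAR⁺ : Subset n → Subset n → Set
  TAR⁺ = TAR G (suc k)

  -- Doubling: the jump x ↦ y becomes the addition of y followed by the removal of x.
  TJ⇒TAR : ∀ {t S T} → Reach G u v (TJ G) t S T → ∣ S ∣ ≡ k → Reach G u v TAR⁺ (2 * t) S T
  TJ⇒TAR (done sep) _ = done sep
  TJ⇒TAR {suc t} {S} {T} (move {S' = S'} sepS (same-size , out , in') rest) ∣S∣
    with TJ⇒jump {S = S} {S'} out in'
  ... | x , y , x∈S , y∉S , refl =
    subst (λ m → Reach G u v TAR⁺ m S T) (sym (double-suc t))
      (move sepS (flip⇒TAR-step S y , ⊔-lub (≤1+ ∣S∣) (≤-reflexive ∣M∣))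
        (move sepM (flip⇒TAR-step M x , ⊔-lub (≤-reflexive ∣M∣) (≤1+ ∣J∣))
          (TJ⇒TAR rest ∣J∣)))
    where
    M = flip S y
    ∣M∣ : ∣ M ∣ ≡ suc k
    ∣M∣ = trans (∣flip∣-∉ y∉S) (cong suc ∣S∣)
    ∣J∣ : ∣ jump S x y ∣ ≡ k
    ∣J∣ = trans (sym same-size) ∣S∣
    ≤1+ : ∀ {a} → a ≡ k → a ≤ suc k
    ≤1+ refl = n≤1+n k
    -- y ends up in the separator jump S x y, so it is neither u nor v.
    avoid : ∀ {w} → w ∉ S → w ∉ jump S x y → w ∉ M
    avoid w∉S w∉J = ∉-flip (∈-∉-≢ (y∈jump x∈S y∉S) w∉J ∘ sym) w∉S
    sepJ = source-separator rest
    sepM : IsSeparator G u v M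
    sepM = separator-⊆ (⊆-flip-∉ ⊆-refl y∉S) (avoid (proj₁ sepS) (proj₁ sepJ))
             (avoid (proj₁ (proj₂ sepS)) (proj₁ (proj₂ sepJ))) sepS

  -- Jumps from A to T whose doubled number is paid for by m TAR steps,
  -- with credit k - |S| for the tokens the current set S lacks.
  JumpsWithin : ℕ → Subset n → Subset n → Subset n → Set
  JumpsWithin m S A T = ∃ λ t → Reach G u v (TJ G) t A T × 2 * t + ∣ S ∣ ≤ m + k

  -- Halving: the invariant A ⊇ S, |A| = k is maintained along the TAR sequence.
  TAR⇒TJ : ∀ {m S T A} → Reach G u v TAR⁺ m S T → ∣ T ∣ ≡ k →
           S ⊆ A → ∣ A ∣ ≡ k → u ∉ A → v ∉ A → JumpsWithin m S A T

  -- The case A = S followed by the addition of x ∉ A: the next step removes some w.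
  TAR⇒TJ-full : ∀ {m x A T} → Reach G u v TAR⁺ m (flip A x) T → ∣ T ∣ ≡ k →
                x ∉ A → ∣ A ∣ ≡ k → IsSeparator G u v A →
                ∃ λ t → Reach G u v (TJ G) t A T × 2 * t ≤ suc m

  TAR⇒TJ (done sepS) ∣S∣ S⊆A ∣A∣ _ _ with ⊆⇒≡ S⊆A (≤-reflexive (trans ∣A∣ (sym ∣S∣)))
  ... | refl = 0 , done sepS , ≤-reflexive ∣S∣
  TAR⇒TJ {suc m} {S} {A = A} (move {S' = S'} sepS (toggle , _) rest) ∣T∣ S⊆A ∣A∣ u∉A v∉A
    with TAR-step⇒flip {S = S} {S'} toggle
  ... | x , refl with x ∈? A | ⊆-split S⊆A
  -- x is toggled inside A: keep A.
  ... | yes x∈A | _ with TAR⇒TJ rest ∣T∣ (flip-⊆ S⊆A x∈A) ∣A∣ u∉A v∉A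
  ...   | t , jumps , b = t , jumps , step-cost t m k (∣p∣≤1+∣flip∣ S x) b
  -- x is added outside A: answer with the jump z ↦ x for some z ∈ A ∖ S.
  TAR⇒TJ {suc m} {S} {A = A} (move sepS (toggle , _) rest) ∣T∣ S⊆A ∣A∣ u∉A v∉A
    | x , refl | no x∉A | inj₂ (z , z∈A , z∉S)
    with TAR⇒TJ rest ∣T∣ S+x⊆A′ (trans (∣jump∣ z∈A x∉A) ∣A∣)
                (avoid (proj₁ sepS+x) u∉A) (avoid (proj₁ (proj₂ sepS+x)) v∉A)
    where
    sepS+x = source-separator rest
    x∈S+x : x ∈ flip S x
    x∈S+x = ∈-flip-self (x∉A ∘ S⊆A)
    S+x⊆A′ : flip S x ⊆ jump A z x
    S+x⊆A′ = ⊆-flip-∉ (flip-mono S⊆A x∉A) (∉-flip (∈-∉-≢ z∈A x∉A) z∉S)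
    avoid : ∀ {w} → w ∉ flip S x → w ∉ A → w ∉ jump A z x
    avoid w∉S+x w∉A = ∉-flip (∈-∉-≢ z∈A w∉A ∘ sym) (∉-flip (∈-∉-≢ x∈S+x w∉S+x ∘ sym) w∉A)
  ... | t , jumps , b =
    suc t , move (separator-⊆ S⊆A u∉A v∉A sepS) (jump⇒TJ z∈A x∉A) jumps ,
    jump-cost t m k (subst (λ s → 2 * t + s ≤ m + k) (∣flip∣-∉ (x∉A ∘ S⊆A)) b)
  -- x is added to S = A itself.
  TAR⇒TJ {suc m} (move sepS (toggle , _) rest) ∣T∣ S⊆A ∣A∣ u∉A v∉A
    | x , refl | no x∉A | inj₁ refl with TAR⇒TJ-full rest ∣T∣ x∉A ∣A∣ sepS
  ... | t , jumps , b = t , jumps , +-mono-≤ b (≤-reflexive ∣A∣)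

  TAR⇒TJ-full {x = x} {A} (done _) ∣T∣ x∉A ∣A∣ _ =
    contradiction (trans (sym (trans (∣flip∣-∉ x∉A) (cong suc ∣A∣))) ∣T∣) 1+n≢n
  TAR⇒TJ-full {suc m} {x} {A} (move {S' = S'} _ (toggle , bnd) rest) ∣T∣ x∉A ∣A∣ sepA
    with TAR-step⇒flip {S = flip A x} {S'} toggle
  ... | w , refl with w ∈? flip A x
  -- A second addition would exceed the bound k + 1.
  ... | no w∉ = contradiction (≤-trans (m≤n⊔m _ _) bnd) (1+n≰n ∘ subst (_≤ suc k) too-big)
    where
    too-big : ∣ flip (flip A x) w ∣ ≡ suc (suc k)
    too-big = trans (∣flip∣-∉ w∉) (cong suc (trans (∣flip∣-∉ x∉A) (cong suc ∣A∣)))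
  ... | yes w∈ with w ≟ x
  -- Removing x again returns to A.
  ...   | yes refl with TAR⇒TJ (subst (λ S → Reach G u v TAR⁺ m S _) (flip-involutive A x) rest)
                        ∣T∣ ⊆-refl ∣A∣ (proj₁ sepA) (proj₁ (proj₂ sepA))
  ...     | t , jumps , b = t , jumps , ≤-trans (cancel-size b ∣A∣) (m≤n+m m 2)
  -- Removing some w ≠ x: the two steps together are the jump w ↦ x.
  TAR⇒TJ-full {suc m} {x} {A} (move _ (toggle , bnd) rest) ∣T∣ x∉A ∣A∣ sepA
    | w , refl | yes w∈ | no w≢x
    with TAR⇒TJ rest ∣T∣ ⊆-refl ∣A′∣ (proj₁ sepA′) (proj₁ (proj₂ sepA′))
    where
    ∣A′∣ = trans (∣jump∣ (∈-flip⁻ w≢x w∈) x∉A) ∣A∣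
    sepA′ = source-separator rest
  ... | t , jumps , b =
    suc t , move sepA (jump⇒TJ (∈-flip⁻ w≢x w∈) x∉A) jumps ,
    double-cost t m (cancel-size b (trans (∣jump∣ (∈-flip⁻ w≢x w∈) x∉A) ∣A∣))

  TAR⇒TJ-halving : ∀ {m S T} → Reach G u v TAR⁺ m S T → ∣ S ∣ ≡ k → ∣ T ∣ ≡ k →
                   ∃ λ t → Reach G u v (TJ G) t S T × 2 * t ≤ m
  TAR⇒TJ-halving reach ∣S∣ ∣T∣ with source-separator reach
  ... | u∉S , v∉S , _ with TAR⇒TJ reach ∣T∣ ⊆-refl ∣S∣ u∉S v∉S
  ...   | t , jumps , b = t , jumps , cancel-size b ∣S∣

IsLeast : (ℕ → Set) → ℕ → Set
IsLeast R d = R d × (∀ m → R m → d ≤ m)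

module DoublingSimulation (P Q : ℕ → Set)
         (double : ∀ {t} → P t → Q (2 * t))
         (halve : ∀ {m} → Q m → ∃ λ t → P t × 2 * t ≤ m) where

  exists-iff : ∃ P ⇔ ∃ Q
  exists-iff = mk⇔ (λ (t , pt) → 2 * t , double pt)
                   (λ (m , qm) → let t , pt , _ = halve qm in t , pt)

  least-double : ∀ d → IsLeast P d → IsLeast Q (2 * d)
  least-double d (pd , least) = double pd , below
    where
    below : ∀ m → Q m → 2 * d ≤ m
    below m qm with halve qm
    ... | t , pt , 2t≤m = ≤-trans (*-monoʳ-≤ 2 (least t pt)) 2t≤m

  least-halve : ∀ d′ → IsLeast Q d′ → ∃ λ d → d′ ≡ 2 * d × IsLeast P d
  least-halve d′ (qd′ , least) with halve qd′
  ... | t , pt , 2t≤d′ = t , d′≡2t , pt , λ m pm →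
        *-cancelˡ-≤ 2 (subst (_≤ 2 * m) d′≡2t (least (2 * m) (double pm)))
    where
    d′≡2t : d′ ≡ 2 * t
    d′≡2t = ≤-antisym (least (2 * t) (double pt)) 2t≤d′

lemma2 : ∀ {n} (G : Graph n) (u v : Fin n) → u ≢ v → ¬ E G u v →
         (Sa Sb : Subset n) (k : ℕ) →
         IsSeparator G u v Sa → IsSeparator G u v Sb →
         ∣ Sa ∣ ≡ k → ∣ Sb ∣ ≡ k →
         (Reconfigurable G u v (TJ G) Sa Sb ⇔ Reconfigurable G u v (TAR G (suc k)) Sa Sb)
         × (∀ d → IsDist G u v (TJ G) Sa Sb d → IsDist G u v (TAR G (suc k)) Sa Sb (2 * d))
         × (∀ d′ → IsDist G u v (TAR G (suc k)) Sa Sb d′ →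
              ∃ λ d → d′ ≡ 2 * d × IsDist G u v (TJ G) Sa Sb d)
lemma2 G u v _ _ Sa Sb k _ _ ∣Sa∣ ∣Sb∣ = exists-iff , least-double , least-halve
  where
  open Translation G u v k
  open DoublingSimulation
         (λ t → Reach G u v (TJ G) t Sa Sb) (λ m → Reach G u v TAR⁺ m Sa Sb)
         (λ jumps → TJ⇒TAR jumps ∣Sa∣) (λ steps → TAR⇒TJ-halving steps ∣Sa∣ ∣Sb∣)
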